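{- For every integer $n\ge 3$ and every positive integer $m$, the $m$-th line digraph $L^m(C_n\cdot C_n)$ is a DNA graph.
   Context: All digraphs are finite. For an arc $a=uv$, $u$ is its tail and $v$ its head. The line digraph $L(D)$ has vertex set $A(D)$, with an arc $xy$ iff the head of $x$ equals the tail of $y$; $L^1(D)=L(D)$, $L^{m+1}(D)=L(L^m(D))$. For integers $\alpha>0$, $k>1$, an $(\alpha,k)$-labeling of $D=(V,A)$ assigns to each vertex $x$ a string $(l_1(x),\dots,l_k(x))$ with entries in $\{1,\dots,\alpha\}$, distinct vertices getting distinct strings, such that for all vertices $x,y$: $xy\in A$ iff $l_i(x)=l_{i-1}(y)$ for all $i\in\{2,\dots,k\}$. A DNA graph is a digraph admitting a $(4,k)$-labeling for some integer $k>1$. The $\infty$-digraph $C_n\cdot C_n$ is obtained from two otherwise vertex-disjoint directed cycles of length $n$ by identifying one vertex of the first with one vertex of the second. -}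

module Defs where

open import Data.Nat using (ℕ; zero; suc; _+_; _*_; _∸_; _<_; _≤_)
open import Data.Fin using (Fin; toℕ)
open import Data.Product using (Σ; _×_; ∃; proj₁; proj₂)
open import Relation.Binary.PropositionalEquality using (_≡_)
open import Function.Bundles using (_⇔_)

record Digraph : Set₁ where
  field
    Vertex : Set
    Arc    : Vertex → Vertex → Set
open Digraph public

ArcOf : Digraph → Set
ArcOf D = Σ (Vertex D) λ u → Σ (Vertex D) λ v → Arc D u v

tail : (D : Digraph) → ArcOf D → Vertex D
tail D a = proj₁ a

head : (D : Digraph) → ArcOf D → Vertex D
head D a = proj₁ (proj₂ a)

L : Digraph → Digraph
L D = record { Vertex = ArcOf D ; Arc = λ x y → head D x ≡ tail D y }

Lpow : ℕ → Digraph → Digraph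
Lpow zero    D = D
Lpow (suc m) D = L (Lpow m D)

-- (α,k)-labeling: each vertex gets a string of length k (positions Fin k,
-- 0-based) with entries in Fin α (≅ {1,…,α}); distinct vertices get distinct
-- strings; xy ∈ A iff l_i(x) = l_{i-1}(y) for all 1-based i ∈ {2,…,k},
-- i.e. for all 0-based positions i, j with toℕ i = suc (toℕ j).
record Labeling (α k : ℕ) (D : Digraph) : Set where
  field
    label     : Vertex D → Fin k → Fin α
    injective : ∀ x y → (∀ i → label x i ≡ label y i) → x ≡ y
    arcs      : ∀ x y → Arc D x y ⇔
                  (∀ (i j : Fin k) → toℕ i ≡ suc (toℕ j) → label x i ≡ label y j)

IsDNAGraph : Digraph → Set
IsDNAGraph D = ∃ λ k → 1 < k × Labeling 4 k D

-- The ∞-digraph C_n · C_n on vertices {0,…,2n-2}: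
-- vertex 0 is the shared vertex; first cycle 0 → 1 → … → n-1 → 0;
-- second cycle 0 → n → n+1 → … → 2n-2 → 0.
data InfArc (n : ℕ) : ℕ → ℕ → Set where
  c1-step  : ∀ i → suc i < n → InfArc n i (suc i)
  c1-close : InfArc n (n ∸ 1) 0
  c2-enter : InfArc n 0 n
  c2-step  : ∀ i → n ≤ i → suc i ≤ 2 * n ∸ 2 → InfArc n i (suc i)
  c2-close : InfArc n (2 * n ∸ 2) 0

Infinity : ℕ → Digraph
Infinity n = record
  { Vertex = Fin (2 * n ∸ 1)
  ; Arc    = λ x y → InfArc n (toℕ x) (toℕ y) }

module Submission where

-- If D has an (α, k+1)-labeling and its arcs are
--    proof-irrelevant (at most one arc u → v), then labelling the arc uv by
--    "first letter of u, followed by the label of v" is an (α, k+2)-labeling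
--    of L(D).  Arcs of L(D) are equalities of vertices of D, which are
--    irrelevant because a labeling makes equality of vertices decidable.
--    Iterating, an (α, k+1)-labeling of D yields an (α, k+1+m)-labeling of
--    L^m(D).
--
-- Write n = k + 1 and h = k − 1.  Let w_c be the infinite
--    word 0^h 1 c 0 0 …, where the colour c is 2 on the first cycle and 3 on
--    the second.  Every vertex has a cycle c and a phase p ≤ k (vertex p of
--    the first cycle, vertex k + p of the second), and it is labelled by the
--    window w_c[p, p + k).  The arcs of C_n·C_n are exactly the phase steps
--    p → p + 1 (staying on the cycle, except when leaving the shared vertex)
--    and k → 0.  The marker 1 or the colour is visible in a window of length
--    h at every phase except 0 and k + 1, which locates the phase; together
--    with the visible colour this gives injectivity and shows that the
--    overlap condition on windows is exactly the phase-step relation.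

open import Defs
open import Data.Nat using (ℕ; zero; suc; _+_; _*_; _∸_; _≤_; _<_; s≤s; z≤n; z<s; s<s⁻¹; _≟_; _≤?_)
open import Data.Nat.Properties
open import Data.Fin as Fin using (Fin; toℕ; fromℕ<; inject₁; #_)
open import Data.Fin.Properties using (toℕ-injective; toℕ-fromℕ<; toℕ<n; toℕ-inject₁; all?)
open import Data.Product using (_×_; _,_; proj₁; proj₂)
open import Data.Sum using (_⊎_; inj₁; inj₂)
open import Data.Empty using (⊥; ⊥-elim)
open import Function using (_∘_)
open import Function.Bundles using (_⇔_; mk⇔; Equivalence)
open import Relation.Nullary using (yes; no; contradiction)
open import Relation.Nullary.Decidable using (map′)
open import Relation.Binary.Definitions using (DecidableEquality)
open import Relation.Binary.PropositionalEquality
import Relation.Binary.HeterogeneousEquality as H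
open import Axiom.UniquenessOfIdentityProofs using (module Decidable⇒UIP)

Overlaps : ∀ {V : Set} {α k} → (V → Fin k → Fin α) → V → V → Set
Overlaps label x y = ∀ i j → toℕ i ≡ suc (toℕ j) → label x i ≡ label y j

ArcIrrelevant : Digraph → Set
ArcIrrelevant D = ∀ u v (p q : Arc D u v) → p ≡ q

module _ {α k : ℕ} {D : Digraph} where

  labeling-≟ : Labeling α k D → DecidableEquality (Vertex D)
  labeling-≟ ℓ x y =
    map′ (injective x y) (λ x≡y i → cong (λ z → label z i) x≡y)
         (all? λ i → label x i Fin.≟ label y i)
    where open Labeling ℓ

  -- Arcs of L(D) are equalities of vertices of D, hence irrelevant
  -- (Hedberg's theorem).
  line-arcIrrelevant : Labeling α k D → ArcIrrelevant (L D)
  line-arcIrrelevant ℓ _ _ = Decidable⇒UIP.≡-irrelevant (labeling-≟ ℓ)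

module LineLabeling {α k : ℕ} {D : Digraph}
                    (arc-irrelevant : ArcIrrelevant D)
                    (ℓ : Labeling α (suc k) D) where
  open Labeling ℓ
  open Equivalence

  arc-overlap : ∀ {u v} → Arc D u v → ∀ (i : Fin k) →
                label u (Fin.suc i) ≡ label v (inject₁ i)
  arc-overlap {u} {v} p i =
    to (arcs u v) p (Fin.suc i) (inject₁ i) (cong suc (sym (toℕ-inject₁ i)))

  tail-determined : ∀ {u u' v} → Arc D u v → Arc D u' v →
                    label u Fin.zero ≡ label u' Fin.zero → u ≡ u'
  tail-determined {u} {u'} {v} p p' first-letter = injective u u' same
    where
    same : ∀ i → label u i ≡ label u' i
    same Fin.zero    = first-letter
    same (Fin.suc i) = trans (arc-overlap p i) (sym (arc-overlap p' i))

  lineLabel : ArcOf D → Fin (suc (suc k)) → Fin α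
  lineLabel (u , _ , _) Fin.zero    = label u Fin.zero
  lineLabel (_ , v , _) (Fin.suc i) = label v i

  line-injective : ∀ x y → (∀ i → lineLabel x i ≡ lineLabel y i) → x ≡ y
  line-injective (u , v , p) (u' , v' , p') same
    with injective v v' (same ∘ Fin.suc)
  ... | refl with tail-determined p p' (same Fin.zero)
  ... | refl = cong (λ r → u , v , r) (arc-irrelevant u v p p')

  line-arcs : ∀ x y → Arc (L D) x y ⇔ Overlaps lineLabel x y
  line-arcs (u , v , p) (u' , v' , p') = mk⇔ forward backward
    where
    forward : v ≡ u' → Overlaps lineLabel (u , v , p) (u' , v' , p')
    forward refl Fin.zero    _           ()
    forward refl (Fin.suc i) Fin.zero    i≡1 = cong (label v) (toℕ-injective (suc-injective i≡1))
    forward refl (Fin.suc i) (Fin.suc j) i≡j+1 = to (arcs v v') p' i j (suc-injective i≡j+1)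

    backward : Overlaps lineLabel (u , v , p) (u' , v' , p') → v ≡ u'
    backward overlapping = injective v u' same
      where
      same : ∀ i → label v i ≡ label u' i
      same Fin.zero    = overlapping (# 1) Fin.zero refl
      same (Fin.suc i) =
        trans (overlapping (Fin.suc (Fin.suc i)) (Fin.suc (inject₁ i))
                       (cong (suc ∘ suc) (sym (toℕ-inject₁ i))))
              (sym (arc-overlap p' i))

  lineLabeling : Labeling α (suc (suc k)) (L D)
  lineLabeling = record { label = lineLabel ; injective = line-injective ; arcs = line-arcs }

iterated-labeling : ∀ {α k D} m → ArcIrrelevant D → Labeling α (suc k) D →
                    Labeling α (suc (m + k)) (Lpow m D) × ArcIrrelevant (Lpow m D)
iterated-labeling zero    irrelevant ℓ = ℓ , irrelevant
iterated-labeling (suc m) irrelevant ℓ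
  with iterated-labeling m irrelevant ℓ
... | ℓₘ , irrelevantₘ = LineLabeling.lineLabeling irrelevantₘ ℓₘ , line-arcIrrelevant ℓₘ

iterated-DNA : ∀ {k D} → ArcIrrelevant D → Labeling 4 (suc (suc k)) D →
               ∀ m → IsDNAGraph (Lpow m D)
iterated-DNA {k} irrelevant ℓ m =
  suc (m + suc k) , s≤s (≤-trans (s≤s z≤n) (m≤n+m (suc k) m)) ,
  proj₁ (iterated-labeling m irrelevant ℓ)

module InfinityDigraph (a : ℕ) where
  -- h: position of the marker; k = n − 1: label length; n: cycle length.
  h k n : ℕ
  h = suc a
  k = suc h
  n = suc k

  two-n : 2 * n ≡ suc (suc (k + k))
  two-n = cong suc (trans (cong (k +_) (cong suc (+-identityʳ k))) (+-suc k k))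

  data Cycle : Set where
    first second : Cycle

  blank marker : Fin 4
  blank  = # 0
  marker = # 1

  colour : Cycle → Fin 4
  colour first  = # 2
  colour second = # 3

  colour-injective : ∀ {c d} → colour c ≡ colour d → c ≡ d
  colour-injective {first}  {first}  _ = refl
  colour-injective {second} {second} _ = refl
  colour-injective {first}  {second} ()
  colour-injective {second} {first}  ()

  word : Cycle → ℕ → Fin 4
  word c q with q ≟ h | q ≟ k
  ... | yes _ | _     = marker
  ... | no _  | yes _ = colour c
  ... | no _  | no _  = blank

  word-at-h : ∀ c → word c h ≡ marker
  word-at-h c with h ≟ h | h ≟ k
  ... | yes _   | _ = refl
  ... | no h≢h  | _ = contradiction refl h≢h

  word-at-k : ∀ c → word c k ≡ colour c
  word-at-k c with k ≟ h | k ≟ k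
  ... | yes k≡h | _       = contradiction k≡h 1+n≢n
  ... | no _    | yes _   = refl
  ... | no _    | no k≢k  = contradiction refl k≢k

  word-blank : ∀ c {q} → q ≢ h → q ≢ k → word c q ≡ blank
  word-blank c {q} q≢h q≢k with q ≟ h | q ≟ k
  ... | yes q≡h | _       = contradiction q≡h q≢h
  ... | no _    | yes q≡k = contradiction q≡k q≢k
  ... | no _    | no _    = refl

  word-colour-free : ∀ c d {q} → q ≢ k → word c q ≡ word d q
  word-colour-free c d {q} q≢k with q ≟ h | q ≟ k
  ... | yes _ | _       = refl
  ... | no _  | yes q≡k = contradiction q≡k q≢k
  ... | no _  | no _    = refl

  marker-position : ∀ c q → word c q ≡ marker → q ≡ h
  marker-position c q w≡marker with q ≟ h | q ≟ k | c
  ... | yes q≡h | _     | _      = q≡h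
  ... | no _    | yes _ | first  = contradiction w≡marker λ ()
  ... | no _    | yes _ | second = contradiction w≡marker λ ()
  ... | no _    | no _  | _      = contradiction w≡marker λ ()

  colour-position : ∀ c d q → word c q ≡ colour d → q ≡ k × c ≡ d
  colour-position c d q w≡colour with q ≟ h | q ≟ k | d
  ... | yes _ | _       | first  = contradiction w≡colour λ ()
  ... | yes _ | _       | second = contradiction w≡colour λ ()
  ... | no _  | yes q≡k | _      = q≡k , colour-injective w≡colour
  ... | no _  | no _    | first  = contradiction w≡colour λ ()
  ... | no _  | no _    | second = contradiction w≡colour λ ()

  blank-before : ∀ c {q} → q < h → word c q ≡ blank
  blank-before c q<h = word-blank c (<⇒≢ q<h) (<⇒≢ (m<n⇒m<1+n q<h))

  blank-after : ∀ c {q} → k < q → word c q ≡ blank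
  blank-after c k<q =
    word-blank c (λ q≡h → <⇒≢ (<-trans (n<1+n h) k<q) (sym q≡h))
                 (λ q≡k → <⇒≢ k<q (sym q≡k))

  Agree : ℕ → Cycle → ℕ → Cycle → ℕ → Set
  Agree r c p d q = ∀ j → j < r → word c (p + j) ≡ word d (q + j)

  agree-sym : ∀ {r c p d q} → Agree r c p d q → Agree r d q c p
  agree-sym agree j j<r = sym (agree j j<r)

  -- Phases whose windows of length h show the marker or the colour.
  data Marked : ℕ → Set where
    marker-inside : ∀ {p} → p < h → Marked (suc p)
    colour-first  : Marked k

  -- Phases whose windows of length h are entirely blank.
  Blank : ℕ → Set
  Blank p = p ≡ 0 ⊎ p ≡ suc k

  marked-or-blank : ∀ {p} → p ≤ suc k → Marked p ⊎ Blank p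
  marked-or-blank {zero}  _ = inj₂ (inj₁ refl)
  marked-or-blank {suc p} p≤k+1 with m≤n⇒m<n∨m≡n (≤-pred p≤k+1)
  ... | inj₂ refl = inj₂ (inj₂ refl)
  ... | inj₁ p<k with m≤n⇒m<n∨m≡n (≤-pred p<k)
  ...   | inj₁ p<h = inj₁ (marker-inside p<h)
  ...   | inj₂ refl = inj₁ colour-first

  marked-phase : ∀ {r c p d q} → h ≤ r → Marked p → Agree r c p d q → p ≡ q
  marked-phase {r} {c} {_} {d} {q} h≤r (marker-inside {p} p<h) agree =
    +-cancelʳ-≡ j (suc p) q (trans reach-marker (sym (marker-position d (q + j) at-marker)))
    where
    j : ℕ
    j = a ∸ p
    reach-marker : suc p + j ≡ h
    reach-marker = cong suc (m+[n∸m]≡n (≤-pred p<h))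
    at-marker : word d (q + j) ≡ marker
    at-marker = trans (sym (agree j (≤-trans (s≤s (m∸n≤m a p)) h≤r)))
                      (trans (cong (word c) reach-marker) (word-at-h c))
  marked-phase {r} {c} {_} {d} {q} h≤r colour-first agree =
    sym (trans (sym (+-identityʳ q)) (proj₁ (colour-position d c (q + 0) at-colour)))
    where
    at-colour : word d (q + 0) ≡ colour c
    at-colour = trans (sym (agree 0 (≤-trans (s≤s z≤n) h≤r)))
                      (trans (cong (word c) (+-identityʳ k)) (word-at-k c))

  phase-agree : ∀ {r c p d q} → h ≤ r → p ≤ suc k → q ≤ suc k →
                Agree r c p d q → p ≡ q ⊎ (Blank p × Blank q)
  phase-agree {r} {c} {p} {d} {q} h≤r p≤ q≤ agree
    with marked-or-blank p≤ | marked-or-blank q≤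
  ... | inj₁ marked-p | _             = inj₁ (marked-phase h≤r marked-p agree)
  ... | inj₂ _        | inj₁ marked-q =
    inj₁ (sym (marked-phase h≤r marked-q (agree-sym {r} {c} {p} {d} {q} agree)))
  ... | inj₂ blank-p  | inj₂ blank-q  = inj₂ (blank-p , blank-q)

  colour-match : ∀ {r c d p} → Agree r c p d p → p ≤ k → k < p + r → c ≡ d
  colour-match {r} {c} {d} {p} agree p≤k k<p+r =
    sym (proj₂ (colour-position d c (p + (k ∸ p)) at-colour))
    where
    j<r : k ∸ p < r
    j<r = subst (k ∸ p <_) (m+n∸m≡n p r) (∸-monoˡ-< k<p+r p≤k)
    at-colour : word d (p + (k ∸ p)) ≡ colour c
    at-colour = trans (sym (agree (k ∸ p) j<r))
                      (trans (cong (word c) (m+[n∸m]≡n p≤k)) (word-at-k c))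

  blank-bounded : ∀ {q} → q ≤ k → Blank q → q ≡ 0
  blank-bounded _   (inj₁ q≡0)  = q≡0
  blank-bounded q≤k (inj₂ refl) = contradiction q≤k 1+n≰n

  Coord : Set
  Coord = Cycle × ℕ

  index : Coord → ℕ
  index (first  , p) = p
  index (second , p) = k + p

  Valid : Coord → Set
  Valid (first  , p) = p ≤ k
  Valid (second , p) = 1 ≤ p × p ≤ k

  phase≤k : ∀ x → Valid x → proj₂ x ≤ k
  phase≤k (first  , _) p≤k       = p≤k
  phase≤k (second , _) (_ , p≤k) = p≤k

  start-is-first : ∀ {c} → Valid (c , 0) → c ≡ first
  start-is-first {first}  _       = refl
  start-is-first {second} (() , _)

  coord : ℕ → Coord
  coord t with t ≤? k
  ... | yes _ = first , t
  ... | no _  = second , t ∸ k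

  coord-low : ∀ {t} → t ≤ k → coord t ≡ (first , t)
  coord-low {t} t≤k with t ≤? k
  ... | yes _   = refl
  ... | no t≰k  = contradiction t≤k t≰k

  coord-high : ∀ {t} → k < t → coord t ≡ (second , t ∸ k)
  coord-high {t} k<t with t ≤? k
  ... | yes t≤k = contradiction t≤k (<⇒≱ k<t)
  ... | no _    = refl

  index-coord : ∀ t → index (coord t) ≡ t
  index-coord t with t ≤? k
  ... | yes _  = refl
  ... | no t≰k = m+[n∸m]≡n (<⇒≤ (≰⇒> t≰k))

  coord-valid : ∀ {t} → t ≤ k + k → Valid (coord t)
  coord-valid {t} t≤2k with t ≤? k
  ... | yes t≤k = t≤k
  ... | no t≰k  = m<n⇒0<n∸m (≰⇒> t≰k) , subst (t ∸ k ≤_) (m+n∸m≡n k k) (∸-monoˡ-≤ k t≤2k)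

  Step : Coord → Coord → Set
  Step (c , p) (d , q) = (q ≡ suc p × (1 ≤ p → c ≡ d)) ⊎ (p ≡ k × q ≡ 0)

  arc⇒step : ∀ {t u} → InfArc n t u → Step (coord t) (coord u)
  arc⇒step (c1-step i si<n) =
    subst₂ Step (sym (coord-low (≤-trans (n≤1+n i) (≤-pred si<n))))
                (sym (coord-low (≤-pred si<n)))
                (inj₁ (refl , λ _ → refl))
  arc⇒step c1-close =
    subst₂ Step (sym (coord-low ≤-refl)) (sym (coord-low z≤n)) (inj₂ (refl , refl))
  arc⇒step c2-enter =
    subst₂ Step (sym (coord-low z≤n)) (sym (coord-high ≤-refl))
                (inj₁ (m+n∸n≡m 1 k , λ ()))
  arc⇒step (c2-step i n≤i _) =
    subst₂ Step (sym (coord-high n≤i)) (sym (coord-high (≤-trans n≤i (n≤1+n i))))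
                (inj₁ (+-∸-assoc 1 (<⇒≤ n≤i) , λ _ → refl))
  arc⇒step c2-close =
    subst₂ Step (sym (trans (cong coord (cong (_∸ 2) two-n)) (coord-high (m<m+n k z<s))))
                (sym (coord-low z≤n))
                (inj₂ (m+n∸m≡n k k , refl))

  step⇒arc : ∀ x y → Valid x → Valid y → Step x y → InfArc n (index x) (index y)
  step⇒arc (first , p) (first , _) _ p+1≤k (inj₁ (refl , _)) = c1-step p (s≤s p+1≤k)
  step⇒arc (first , zero) (second , _) _ _ (inj₁ (refl , _)) =
    subst (InfArc n 0) (sym (+-comm k 1)) c2-enter
  step⇒arc (first , suc p) (second , _) _ _ (inj₁ (refl , same)) =
    contradiction (same (s≤s z≤n)) λ ()
  step⇒arc (second , p) (first , _) (1≤p , _) _ (inj₁ (refl , same)) =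
    contradiction (same 1≤p) λ ()
  step⇒arc (second , p) (second , _) (1≤p , _) (_ , p+1≤k) (inj₁ (refl , _)) =
    subst (InfArc n (k + p)) (sym (+-suc k p)) (c2-step (k + p) n≤k+p k+p+1≤2n-2)
    where
    n≤k+p : n ≤ k + p
    n≤k+p = subst (_≤ k + p) (+-comm k 1) (+-monoʳ-≤ k 1≤p)
    k+p+1≤2n-2 : suc (k + p) ≤ 2 * n ∸ 2
    k+p+1≤2n-2 = subst (suc (k + p) ≤_) (sym (cong (_∸ 2) two-n))
                       (subst (_≤ k + k) (+-suc k p) (+-monoʳ-≤ k p+1≤k))
  step⇒arc (first , _) (first , _) _ _ (inj₂ (refl , refl)) = c1-close
  step⇒arc (second , _) (first , _) _ _ (inj₂ (refl , refl)) =
    subst (λ t → InfArc n t 0) (cong (_∸ 2) two-n) c2-close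
  step⇒arc (_ , _) (second , _) _ (() , _) (inj₂ (refl , refl))

  Shift : Coord → Coord → Set
  Shift (c , p) (d , q) = Agree h c (suc p) d q

  -- A phase step shifts the window by one: the letters that could differ
  -- are the colour (irrelevant when leaving phase 0) or blanks.
  step⇒shift : ∀ x y → Step x y → Shift x y
  step⇒shift (c , zero) (d , _) (inj₁ (refl , _)) j j<h =
    word-colour-free c d (<⇒≢ (s≤s j<h))
  step⇒shift (c , suc p) (d , _) (inj₁ (refl , same)) j _ =
    cong (λ e → word e (suc (suc p) + j)) (same (s≤s z≤n))
  step⇒shift (c , _) (d , _) (inj₂ (refl , refl)) j j<h =
    trans (blank-after c (s≤s (m≤m+n k j))) (sym (blank-before d j<h))

  -- Conversely, a shift between windows forces a phase step (phase-agree
  -- locates the phase, colour-match fixes the cycle).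
  shift⇒step : ∀ x y → proj₂ x ≤ k → proj₂ y ≤ k → Shift x y → Step x y
  shift⇒step (c , p) (d , q) p≤k q≤k shift
    with phase-agree ≤-refl (s≤s p≤k) (≤-trans q≤k (n≤1+n k)) shift
  ... | inj₁ refl =
    inj₁ (refl , λ 1≤p → colour-match shift q≤k (s≤s (+-monoˡ-≤ h 1≤p)))
  ... | inj₂ (inj₂ p+1≡k+1 , blank-q) =
    inj₂ (suc-injective p+1≡k+1 , blank-bounded q≤k blank-q)

  window : Coord → Fin k → Fin 4
  window (c , p) i = word c (p + toℕ i)

  shift⇒overlap : ∀ x y → Shift x y → Overlaps window x y
  shift⇒overlap (c , p) (d , q) shift i j i≡j+1 = begin
    word c (p + toℕ i)          ≡⟨ cong (λ m → word c (p + m)) i≡j+1 ⟩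
    word c (p + suc (toℕ j))    ≡⟨ cong (word c) (+-suc p (toℕ j)) ⟩
    word c (suc p + toℕ j)      ≡⟨ shift (toℕ j) (s<s⁻¹ (subst (_< k) i≡j+1 (toℕ<n i))) ⟩
    word d (q + toℕ j)          ∎
    where open ≡-Reasoning

  overlap⇒shift : ∀ x y → Overlaps window x y → Shift x y
  overlap⇒shift (c , p) (d , q) overlapping j j<h = begin
    word c (suc p + j)          ≡⟨ cong (word c) (sym (+-suc p j)) ⟩
    word c (p + suc j)          ≡⟨ cong (λ m → word c (p + m)) (sym (toℕ-fromℕ< j+1<k)) ⟩
    word c (p + toℕ (fromℕ< j+1<k))
      ≡⟨ overlapping (fromℕ< j+1<k) (fromℕ< j<k)
                 (trans (toℕ-fromℕ< j+1<k) (cong suc (sym (toℕ-fromℕ< j<k)))) ⟩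
    word d (q + toℕ (fromℕ< j<k)) ≡⟨ cong (λ m → word d (q + m)) (toℕ-fromℕ< j<k) ⟩
    word d (q + j)              ∎
    where
    open ≡-Reasoning
    j+1<k : suc j < k
    j+1<k = s≤s j<h
    j<k : j < k
    j<k = m<n⇒m<1+n j<h

  window-agree : ∀ {c p d q} → (∀ i → window (c , p) i ≡ window (d , q) i) →
                 Agree k c p d q
  window-agree {c} {p} {d} {q} same j j<k =
    subst (λ m → word c (p + m) ≡ word d (q + m)) (toℕ-fromℕ< j<k) (same (fromℕ< j<k))

  agree-phase : ∀ {c p d q} → p ≤ k → q ≤ k → Agree k c p d q → p ≡ q
  agree-phase p≤k q≤k agree
    with phase-agree (n≤1+n h) (≤-trans p≤k (n≤1+n k)) (≤-trans q≤k (n≤1+n k)) agree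
  ... | inj₁ p≡q              = p≡q
  ... | inj₂ (blank-p , blank-q) = trans (blank-bounded p≤k blank-p) (sym (blank-bounded q≤k blank-q))

  agree-cycle : ∀ {c d p} → Valid (c , p) → Valid (d , p) → Agree k c p d p → c ≡ d
  agree-cycle {p = zero}  valid-c valid-d _ =
    trans (start-is-first valid-c) (sym (start-is-first valid-d))
  agree-cycle {c} {p = suc p} valid-c _ agree =
    colour-match agree (phase≤k (c , suc p) valid-c) (s≤s (m≤n+m k p))

  agree-coord : ∀ c p d q → Valid (c , p) → Valid (d , q) →
                Agree k c p d q → (c , p) ≡ (d , q)
  agree-coord c p d q valid-x valid-y agree
    with agree-phase {c} {p} {d} {q} (phase≤k _ valid-x) (phase≤k _ valid-y) agree
  ... | refl = cong (_, p) (agree-cycle {c} {d} {p} valid-x valid-y agree)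

  window-injective : ∀ x y → Valid x → Valid y →
                     (∀ i → window x i ≡ window y i) → x ≡ y
  window-injective (c , p) (d , q) valid-x valid-y same =
    agree-coord c p d q valid-x valid-y (window-agree {c} {p} {d} {q} same)

  position : Vertex (Infinity n) → Coord
  position t = coord (toℕ t)

  position-valid : ∀ t → Valid (position t)
  position-valid t = coord-valid (≤-pred (subst (toℕ t <_) (cong (_∸ 1) two-n) (toℕ<n t)))

  infinity-labeling : Labeling 4 k (Infinity n)
  infinity-labeling = record
    { label     = window ∘ position
    ; injective = injective
    ; arcs      = arcs
    }
    where
    injective : ∀ t u → (∀ i → window (position t) i ≡ window (position u) i) → t ≡ u
    injective t u same = toℕ-injective (begin
      toℕ t             ≡⟨ sym (index-coord (toℕ t)) ⟩
      index (position t) ≡⟨ cong index (window-injective _ _ (position-valid t) (position-valid u) same) ⟩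
      index (position u) ≡⟨ index-coord (toℕ u) ⟩
      toℕ u             ∎)
      where open ≡-Reasoning

    arcs : ∀ t u → InfArc n (toℕ t) (toℕ u) ⇔ Overlaps (window ∘ position) t u
    arcs t u = mk⇔
      (λ arc → shift⇒overlap x y (step⇒shift x y (arc⇒step arc)))
      (λ overlapping →
        subst₂ (InfArc n) (index-coord (toℕ t)) (index-coord (toℕ u))
          (step⇒arc x y (position-valid t) (position-valid u)
            (shift⇒step x y (phase≤k x (position-valid t)) (phase≤k y (position-valid u))
              (overlap⇒shift x y overlapping))))
      where
      x y : Coord
      x = position t
      y = position u

  cycles-disjoint : ∀ {i} → suc i < n → n ≤ i → ⊥
  cycles-disjoint {i} si<n n≤i = 1+n≰n (≤-trans (n≤1+n (suc i)) (≤-trans si<n n≤i))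
  closes-distinct : k ≢ 2 * n ∸ 2
  closes-distinct k≡2n-2 = m≢1+m+n k (trans k≡2n-2 (trans (cong (_∸ 2) two-n) (+-suc k h)))

  arc-unique : ∀ {t u t' u'} (p : InfArc n t u) (q : InfArc n t' u') →
               t ≡ t' → u ≡ u' → p H.≅ q
  arc-unique (c1-step i l) (c1-step .i l') refl refl = H.≡-to-≅ (cong (c1-step i) (<-irrelevant l l'))
  arc-unique c1-close c1-close _ _ = H.refl
  arc-unique c2-enter c2-enter _ _ = H.refl
  arc-unique (c2-step i l₁ l₂) (c2-step .i l₁' l₂') refl refl =
    H.≡-to-≅ (cong₂ (c2-step i) (≤-irrelevant l₁ l₁') (≤-irrelevant l₂ l₂'))
  arc-unique c2-close c2-close _ _ = H.refl
  arc-unique (c1-step _ _) c1-close _ ()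
  arc-unique (c1-step _ _) c2-enter refl ()
  arc-unique (c1-step i l) (c2-step .i l₁ _) refl _ = ⊥-elim (cycles-disjoint l l₁)
  arc-unique (c1-step _ _) c2-close _ ()
  arc-unique c1-close (c1-step _ _) _ ()
  arc-unique c1-close c2-enter () _
  arc-unique c1-close (c2-step _ _ _) _ ()
  arc-unique c1-close c2-close k≡2n-2 _ = ⊥-elim (closes-distinct k≡2n-2)
  arc-unique c2-enter (c1-step _ _) refl ()
  arc-unique c2-enter c1-close () _
  arc-unique c2-enter (c2-step .0 () _) refl _
  arc-unique c2-enter c2-close _ ()
  arc-unique (c2-step i l₁ _) (c1-step .i l) refl _ = ⊥-elim (cycles-disjoint l l₁)
  arc-unique (c2-step _ _ _) c1-close _ ()
  arc-unique (c2-step .0 () _) c2-enter refl _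
  arc-unique (c2-step _ _ _) c2-close _ ()
  arc-unique c2-close (c1-step _ _) _ ()
  arc-unique c2-close c1-close 2n-2≡k _ = ⊥-elim (closes-distinct (sym 2n-2≡k))
  arc-unique c2-close c2-enter _ ()
  arc-unique c2-close (c2-step _ _ _) _ ()

  infinity-arcIrrelevant : ArcIrrelevant (Infinity n)
  infinity-arcIrrelevant _ _ p q = H.≅-to-≡ (arc-unique p q refl refl)

theorem8 : (n m : ℕ) → 3 ≤ n → 1 ≤ m → IsDNAGraph (Lpow m (Infinity n))
theorem8 (suc (suc (suc a))) m (s≤s (s≤s (s≤s z≤n))) _ =
  iterated-DNA infinity-arcIrrelevant infinity-labeling m
  where open InfinityDigraph a
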